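{- For integers $m,n$ with $4\leqslant m\leqslant 2n-2$, $\kappa(AQ_n; K_{1,m})\leqslant \left\lceil\frac{n-1}{2}\right\rceil$.
   Context: All graphs are finite, simple and undirected. The $n$-dimensional augmented cube $AQ_n$ has as vertices all $n$-bit binary strings $a_na_{n-1}\ldots a_1$. $AQ_1=K_2$. For $n\geqslant 2$, $AQ_n$ is obtained from two copies $AQ^0_{n-1}$ (vertices $0a_{n-1}\ldots a_1$) and $AQ^1_{n-1}$ (vertices $1b_{n-1}\ldots b_1$) of $AQ_{n-1}$ by joining $0a_{n-1}\ldots a_1$ to $1b_{n-1}\ldots b_1$ iff either $a_i=b_i$ for all $1\leqslant i\leqslant n-1$ or $a_i=1-b_i$ for all $1\leqslant i\leqslant n-1$. Equivalently, for $u=u_n\ldots u_1$, writing $u^i$ for $u$ with bit $i$ flipped and $\overline{u}^i$ for $u$ with bits $1,\ldots,i$ all flipped, $N_{AQ_n}(u)=\{u^i:1\leqslant i\leqslant n\}\cup\{\overline{u}^i:2\leqslant i\leqslant n\}$. $K_{1,m}$ denotes the star with $m$ leaves. For a set $F$ of subgraphs of a graph $G$, let $V(F)$ be the set of vertices contained in some member of $F$; $F$ is a subgraph cut of $G$ if $G-V(F)$ is disconnected or consists of a single vertex. For a connected graph $H$, an $H$-structure cut is a subgraph cut each of whose members is isomorphic to $H$; $\kappa(G;H)$ is the minimum cardinality of an $H$-structure cut of $G$. -}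

module Defs where

open import Data.Nat using (ℕ; zero; suc; _≤ᵇ_)
open import Data.Bool using (Bool; not; if_then_else_)
open import Data.Fin using (Fin; toℕ)
open import Data.Vec using (Vec; updateAt; tabulate; lookup)
open import Data.List using (List; length)
open import Data.List.Membership.Propositional using (_∈_; _∉_)
open import Data.List.Relation.Unary.All using (All)
open import Data.List.Relation.Unary.Any using (Any)
open import Data.List.Relation.Unary.Unique.Propositional using (Unique)
open import Data.Product using (Σ; ∃; _×_; _,_)
open import Data.Sum using (_⊎_)
open import Relation.Nullary using (¬_)
open import Relation.Binary.PropositionalEquality using (_≡_; _≢_)

record Graph : Set₁ where
  field
    Vertex : Set
    Adj    : Vertex → Vertex → Set
open Graph public

-- Augmented cube AQ_n.
-- A vertex u = u_n … u_1 is a Vec Bool n; position k : Fin n holds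
-- bit number (toℕ k + 1).

flipBit : ∀ {n} → Vec Bool n → Fin n → Vec Bool n
flipBit u k = updateAt u k not

flipUpTo : ∀ {n} → Vec Bool n → Fin n → Vec Bool n
flipUpTo u k = tabulate λ j →
  if toℕ j ≤ᵇ toℕ k then not (lookup u j) else lookup u j

data AQAdj {n : ℕ} (u : Vec Bool n) : Vec Bool n → Set where
  hyp : (k : Fin n) → AQAdj u (flipBit u k)
  aug : (k : Fin n) → 1 Data.Nat.≤ toℕ k → AQAdj u (flipUpTo u k)

AQ : ℕ → Graph
AQ n = record { Vertex = Vec Bool n ; Adj = AQAdj }

record Star (G : Graph) (m : ℕ) : Set where
  field
    centre      : Vertex G
    leaves      : List (Vertex G)
    leaves-len  : length leaves ≡ m
    leaves-uniq : Unique leaves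
    centre∉     : centre ∉ leaves
    leaves-adj  : All (Adj G centre) leaves
open Star public

InV : {G : Graph} {m : ℕ} → List (Star G m) → Vertex G → Set
InV F v = Any (λ S → v ≡ centre S ⊎ v ∈ leaves S) F

-- connectivity in G - X  (X a predicate on vertices, here V(F))
data Reach (G : Graph) (X : Vertex G → Set) : Vertex G → Vertex G → Set where
  here : ∀ {u} → ¬ X u → Reach G X u u
  step : ∀ {u v w} → ¬ X u → Adj G u v → Reach G X v w → Reach G X u w

Disconnected : (G : Graph) → (Vertex G → Set) → Set
Disconnected G X =
  Σ (Vertex G) λ u → Σ (Vertex G) λ v →
    ¬ X u × ¬ X v × ¬ Reach G X u v

Trivial : (G : Graph) → (Vertex G → Set) → Set
Trivial G X = Σ (Vertex G) λ u → ¬ X u × (∀ w → ¬ X w → w ≡ u)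

IsStarCut : (G : Graph) (m : ℕ) → List (Star G m) → Set
IsStarCut G m F = Disconnected G (InV F) ⊎ Trivial G (InV F)

-- κ(G; K_{1,m}) ≤ k : some K_{1,m}-structure cut has at most k members.
-- (A list F of length ≤ k; repetitions only lower the cardinality of
-- the underlying set, so this is exactly "min cardinality ≤ k".)
κStar≤ : (G : Graph) (m k : ℕ) → Set
κStar≤ G m k = Σ (List (Star G m)) λ F → IsStarCut G m F × length F Data.Nat.≤ k

-- Let u = 0⋯0.  For 1 ≤ j ≤ ⌊n/2⌋ the vertex c_j = ū^{2j} is a neighbour of u, and among its own
-- neighbours are ū^{2j-1}, u^{2j} and, when 2j < n, also ū^{2j+1} and u^{2j+1}.  Together with the
-- c_j these exhaust N(u), because ū^1 = u^1.  Since AQ_n is (2n-1)-regular and 4 ≤ m ≤ 2n-2, each c_j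
-- is the centre of a K_{1,m} containing these at most four vertices but not u.  Deleting the
-- ⌊n/2⌋ = ⌈(n-1)/2⌉ stars isolates u, while 0⋯0101 survives: it is no c_j, the ū-neighbours of c_j
-- end in 0, and changing one bit of 0⋯01⋯1 (with 2j ones) never gives 0⋯0101.
module Submission where

open import Defs
open import Data.Nat using (ℕ; _≤_; _*_; _∸_; ⌈_/2⌉)
open import Data.Nat as ℕ using (zero; suc; _+_; _<_; z≤n; s≤s; ⌊_/2⌋; _≤ᵇ_; _<ᵇ_; _≡ᵇ_; _<?_)
open import Data.Nat.Properties
  using (≤-refl; ≤-trans; ≤-reflexive; ≤-antisym; ≤-pred; <⇒≤; <⇒≢; +-monoˡ-≤; +-identityʳ; *-suc;
         m≤n⇒m⊓n≡m; ≡ᵇ⇒≡; ≡⇒≡ᵇ; ≤ᵇ⇒≤; ≤⇒≤ᵇ; module ≤-Reasoning)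
open import Data.Bool as Bool using (Bool; true; false; not; _xor_; if_then_else_; T)
open import Data.Bool.Properties using (xor-comm; xor-assoc; xor-identityʳ; not-injective)
open import Data.Fin using (Fin; zero; suc; toℕ; fromℕ<)
open import Data.Fin.Properties using (toℕ-injective; toℕ-fromℕ<; toℕ<n; suc-injective)
open import Data.Vec using (Vec; lookup; replicate)
open import Data.Vec.Properties
  using (lookup∘updateAt; lookup∘updateAt′; lookup∘tabulate; tabulate∘lookup; tabulate-cong;
         lookup-replicate; ≡-dec)
open import Data.List as List using (List; []; _∷_; _++_; [_]; length; filter; take; allFin)
open import Data.List.Properties
  using (length-++; length-removeAt′; length-take; length-map; length-tabulate)
open import Data.List.Membership.Propositional using (_∈_; _∉_; _─_; lose)
open import Data.List.Membership.Propositional.Properties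
  using (∈-filter⁺; ∈-filter⁻; ∈-++⁺ˡ; ∈-++⁺ʳ; ∈-tabulate⁺; ∈-tabulate⁻; ∈-map⁺; ∈-allFin)
open import Data.List.Relation.Unary.Any using (here; there; index; satisfied)
open import Data.List.Relation.Unary.Any.Properties using (map⁻)
open import Data.List.Relation.Unary.All as All using (All)
import Data.List.Relation.Unary.All.Properties as All
open import Data.List.Relation.Unary.Unique.Propositional using (Unique; []; _∷_)
import Data.List.Relation.Unary.Unique.Propositional.Properties as Unique
open import Data.List.Relation.Binary.Subset.Propositional using (_⊆_)
open import Data.List.Relation.Binary.Disjoint.Propositional using (Disjoint)
open import Data.List.Relation.Binary.Permutation.Propositional
  using (_↭_; ↭-refl; ↭-sym; ↭-trans; prep; ↭⇒↭ₛ)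
open import Data.List.Relation.Binary.Permutation.Propositional.Properties
  using (shift; ↭-length; ∈-resp-↭)
import Data.List.Relation.Binary.Permutation.Setoid.Properties as ↭ₛ
import Data.List.Relation.Binary.Sublist.Propositional.Properties as Sublist
open import Data.Product using (∃; _×_; _,_; proj₁; proj₂)
open import Data.Sum using (_⊎_; inj₁; inj₂)
open import Data.Unit using (tt)
open import Data.Empty using (⊥-elim)
open import Function using (_∘_; id)
open import Relation.Nullary using (¬_; Dec; yes; no; does; contradiction)
open import Relation.Unary using (Pred; Decidable)
open import Relation.Unary.Properties using (∁?)
open import Relation.Binary using (DecidableEquality)
open import Relation.Binary.PropositionalEquality
  using (_≡_; _≢_; refl; sym; trans; cong; cong₂; subst; setoid; module ≡-Reasoning)

<ᵇ-suc : ∀ a b → (a <ᵇ suc b) ≡ (a <ᵇ b) xor (a ≡ᵇ b)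
<ᵇ-suc zero zero = refl
<ᵇ-suc zero (suc b) = refl
<ᵇ-suc (suc a) zero = refl
<ᵇ-suc (suc a) (suc b) = <ᵇ-suc a b

≤ᵇ-suc : ∀ a {b c} → c ≡ suc b → (a ≤ᵇ c) ≡ (a ≤ᵇ b) xor (a ≡ᵇ c)
≤ᵇ-suc zero refl = refl
≤ᵇ-suc (suc a) {b} refl = <ᵇ-suc a b

≤ᵇ-zero : ∀ a → (a ≤ᵇ 0) ≡ (a ≡ᵇ 0)
≤ᵇ-zero zero = refl
≤ᵇ-zero (suc a) = refl

xor-cancelʳ : ∀ x b → (x xor b) xor b ≡ x
xor-cancelʳ false false = refl
xor-cancelʳ false true = refl
xor-cancelʳ true false = refl
xor-cancelʳ true true = refl

xor-injectiveʳ : ∀ x {a b} → x xor a ≡ x xor b → a ≡ b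
xor-injectiveʳ false a≡b = a≡b
xor-injectiveʳ true = not-injective

data ParityView : ℕ → Set where
  zero : ParityView 0
  odd  : ∀ j → ParityView (suc (j * 2))
  even : ∀ j → ParityView (suc (suc (j * 2)))

parityView : ∀ a → ParityView a
parityView zero = zero
parityView (suc zero) = odd 0
parityView (suc (suc a)) with parityView a
... | zero = even 0
... | odd j = odd (suc j)
... | even j = even (suc j)

1+m*2<n⇒m<⌊n/2⌋ : ∀ {m n} → suc (m * 2) < n → m < ⌊ n /2⌋
1+m*2<n⇒m<⌊n/2⌋ {zero} {suc zero} (s≤s ())
1+m*2<n⇒m<⌊n/2⌋ {zero} {suc (suc n)} _ = s≤s z≤n
1+m*2<n⇒m<⌊n/2⌋ {suc m} {suc (suc n)} (s≤s (s≤s 1+m*2<n)) = s≤s (1+m*2<n⇒m<⌊n/2⌋ 1+m*2<n)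

m<⌊n/2⌋⇒1+m*2<n : ∀ {m n} → m < ⌊ n /2⌋ → suc (m * 2) < n
m<⌊n/2⌋⇒1+m*2<n {zero} {suc (suc n)} _ = s≤s (s≤s z≤n)
m<⌊n/2⌋⇒1+m*2<n {suc m} {suc (suc n)} (s≤s m<⌊n/2⌋) = s≤s (s≤s (m<⌊n/2⌋⇒1+m*2<n m<⌊n/2⌋))

2*[1+n]∸2≡n+n : ∀ n → 2 * suc n ∸ 2 ≡ n + n
2*[1+n]∸2≡n+n n = trans (cong (_∸ 2) (*-suc 2 n)) (cong (n +_) (+-identityʳ n))

module _ {A : Set} where

  ∈-─⁺ : ∀ {x y : A} {ys} (x∈ys : x ∈ ys) → y ∈ ys → y ≢ x → y ∈ ys ─ x∈ys
  ∈-─⁺ (here refl) (here refl) y≢x = ⊥-elim (y≢x refl)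
  ∈-─⁺ (here refl) (there y∈ys) _ = y∈ys
  ∈-─⁺ (there x∈ys) (here refl) _ = here refl
  ∈-─⁺ (there x∈ys) (there y∈ys) y≢x = there (∈-─⁺ x∈ys y∈ys y≢x)

  unique-⊆⇒length-≤ : ∀ {xs ys : List A} → Unique xs → xs ⊆ ys → length xs ≤ length ys
  unique-⊆⇒length-≤ [] _ = z≤n
  unique-⊆⇒length-≤ {x ∷ xs} {ys} (x≢xs ∷ xs!) xs⊆ys =
    ≤-trans (s≤s (unique-⊆⇒length-≤ xs! λ y∈xs →
                    ∈-─⁺ x∈ys (xs⊆ys (there y∈xs)) (All.lookup x≢xs y∈xs ∘ sym)))
            (≤-reflexive (sym (length-removeAt′ ys (index x∈ys))))
    where x∈ys = xs⊆ys (here refl)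

  filter-++-filter∁-↭ : ∀ {ℓ} {P : Pred A ℓ} (P? : Decidable P) xs →
                        filter P? xs ++ filter (∁? P?) xs ↭ xs
  filter-++-filter∁-↭ P? [] = ↭-refl
  filter-++-filter∁-↭ P? (x ∷ xs) with does (P? x)
  ... | true = prep x (filter-++-filter∁-↭ P? xs)
  ... | false = ↭-trans (shift x (filter P? xs) _) (prep x (filter-++-filter∁-↭ P? xs))

  ∈-take-++⁺ˡ : ∀ m {x : A} {xs ys} → x ∈ xs → length xs ≤ m → x ∈ take m (xs ++ ys)
  ∈-take-++⁺ˡ (suc m) (here refl) _ = here refl
  ∈-take-++⁺ˡ (suc m) (there x∈xs) (s≤s |xs|≤m) = there (∈-take-++⁺ˡ m x∈xs |xs|≤m)

  module _ (_≟_ : DecidableEquality A) where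

    length-filter-≢ : ∀ {x : A} {xs} → Unique xs → length xs ≤ suc (length (filter (∁? (_≟ x)) xs))
    length-filter-≢ {x} {xs} xs! = begin
      length xs                                                  ≡⟨ ↭-length split ⟨
      length (filter (_≟ x) xs ++ filter (∁? (_≟ x)) xs)         ≡⟨ length-++ (filter (_≟ x) xs) ⟩
      length (filter (_≟ x) xs) + length (filter (∁? (_≟ x)) xs) ≤⟨ +-monoˡ-≤ _ at-most-one ⟩
      suc (length (filter (∁? (_≟ x)) xs))                       ∎
      where
      open ≤-Reasoning
      split = filter-++-filter∁-↭ (_≟ x) xs
      at-most-one : length (filter (_≟ x) xs) ≤ length [ x ]
      at-most-one = unique-⊆⇒length-≤ {ys = [ x ]} (Unique.filter⁺ (_≟ x) xs!)
                                      (here ∘ proj₂ ∘ ∈-filter⁻ (_≟ x) {xs = xs})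

module StarAvoiding {G : Graph} (_≟_ : DecidableEquality (Vertex G))
  {c : Vertex G} {ns : List (Vertex G)}
  (ns-unique : Unique ns) (ns-adjacent : All (Adj G c) ns) (c∉ns : c ∉ ns)
  (u : Vertex G) (wanted : List (Vertex G)) {m : ℕ}
  (|wanted|≤m : length wanted ≤ m) (m<|ns| : m < length ns)
  where

  open import Data.List.Membership.DecPropositional _≟_ using (_∈?_)

  private
    pool preferred others : List (Vertex G)
    pool = filter (∁? (_≟ u)) ns
    preferred = filter (_∈? wanted) pool
    others = filter (∁? (_∈? wanted)) pool

    ranked↭pool : preferred ++ others ↭ pool
    ranked↭pool = filter-++-filter∁-↭ (_∈? wanted) pool

    pool-unique : Unique pool
    pool-unique = Unique.filter⁺ (∁? (_≟ u)) ns-unique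

    m≤|ranked| : m ≤ length (preferred ++ others)
    m≤|ranked| = ≤-trans (≤-pred (≤-trans m<|ns| (length-filter-≢ _≟_ ns-unique)))
                         (≤-reflexive (sym (↭-length ranked↭pool)))

    leaves⊆pool : take m (preferred ++ others) ⊆ pool
    leaves⊆pool = ∈-resp-↭ ranked↭pool ∘ Sublist.Any-resp-⊆ (Sublist.take-⊆ m _)

    leaves⊆ns : take m (preferred ++ others) ⊆ ns
    leaves⊆ns = proj₁ ∘ ∈-filter⁻ (∁? (_≟ u)) {xs = ns} ∘ leaves⊆pool

  star : Star G m
  star = record
    { centre      = c
    ; leaves      = take m (preferred ++ others)
    ; leaves-len  = trans (length-take m _) (m≤n⇒m⊓n≡m m≤|ranked|)
    ; leaves-uniq = Unique.take⁺ m (↭ₛ.Unique-resp-↭ (setoid _) (↭⇒↭ₛ (↭-sym ranked↭pool)) pool-unique)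
    ; centre∉     = c∉ns ∘ leaves⊆ns
    ; leaves-adj  = All.tabulate (All.lookup ns-adjacent ∘ leaves⊆ns)
    }

  u∉leaves : u ∉ leaves star
  u∉leaves u∈leaves = proj₂ (∈-filter⁻ (∁? (_≟ u)) {xs = ns} (leaves⊆pool u∈leaves)) refl

  wanted∈leaves : ∀ {x} → x ∈ wanted → x ∈ ns → x ≢ u → x ∈ leaves star
  wanted∈leaves x∈wanted x∈ns x≢u =
    ∈-take-++⁺ˡ m (∈-filter⁺ (_∈? wanted) (∈-filter⁺ (∁? (_≟ u)) x∈ns x≢u) x∈wanted) |preferred|≤m
    where
    |preferred|≤m : length preferred ≤ m
    |preferred|≤m = ≤-trans (unique-⊆⇒length-≤ (Unique.filter⁺ (_∈? wanted) pool-unique)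
                                                (proj₂ ∘ ∈-filter⁻ (_∈? wanted) {xs = pool}))
                            |wanted|≤m

module _ {G : Graph} {X : Vertex G → Set} where

  Reach-source : ∀ {u v} → Reach G X u v → ¬ X u
  Reach-source (here ¬Xu) = ¬Xu
  Reach-source (step ¬Xu _ _) = ¬Xu

  isolated⇒¬Reach : ∀ {u v} → u ≢ v → (∀ {w} → Adj G u w → X w) → ¬ Reach G X u v
  isolated⇒¬Reach u≢v _ (here _) = u≢v refl
  isolated⇒¬Reach _ N[u]⊆X (step _ u~w w⇝v) = Reach-source w⇝v (N[u]⊆X u~w)

module _ {n : ℕ} where

  vec-ext : ∀ {v w : Vec Bool n} → (∀ i → lookup v i ≡ lookup w i) → v ≡ w
  vec-ext {v} {w} v≗w = trans (sym (tabulate∘lookup v)) (trans (tabulate-cong v≗w) (tabulate∘lookup w))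

  lookup-flipBit : ∀ (w : Vec Bool n) k i → lookup (flipBit w k) i ≡ lookup w i xor (toℕ i ≡ᵇ toℕ k)
  lookup-flipBit w k i = flip-if (toℕ i ℕ.≟ toℕ k)
    where
    flip-if : (i≟k : Dec (toℕ i ≡ toℕ k)) → lookup (flipBit w k) i ≡ lookup w i xor does i≟k
    flip-if (yes i≡k) rewrite toℕ-injective i≡k = trans (lookup∘updateAt k w) (xor-comm true _)
    flip-if (no i≢k) = trans (lookup∘updateAt′ i k (i≢k ∘ cong toℕ) w) (xor-comm false _)

  lookup-flipUpTo : ∀ (w : Vec Bool n) k i → lookup (flipUpTo w k) i ≡ lookup w i xor (toℕ i ≤ᵇ toℕ k)
  lookup-flipUpTo w k i = trans (lookup∘tabulate _ i) (if-not≡xor (toℕ i ≤ᵇ toℕ k))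
    where
    if-not≡xor : ∀ b {x} → (if b then not x else x) ≡ x xor b
    if-not≡xor true = xor-comm true _
    if-not≡xor false = xor-comm false _

  flipBit-involutive : ∀ (w : Vec Bool n) k → flipBit (flipBit w k) k ≡ w
  flipBit-involutive w k = vec-ext λ i → begin
    lookup (flipBit (flipBit w k) k) i                      ≡⟨ lookup-flipBit (flipBit w k) k i ⟩
    lookup (flipBit w k) i xor (toℕ i ≡ᵇ toℕ k)              ≡⟨ cong (_xor _) (lookup-flipBit w k i) ⟩
    (lookup w i xor (toℕ i ≡ᵇ toℕ k)) xor (toℕ i ≡ᵇ toℕ k)   ≡⟨ xor-cancelʳ (lookup w i) _ ⟩
    lookup w i                                               ∎
    where open ≡-Reasoning

  flipUpTo-involutive : ∀ (w : Vec Bool n) k → flipUpTo (flipUpTo w k) k ≡ w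
  flipUpTo-involutive w k = vec-ext λ i → begin
    lookup (flipUpTo (flipUpTo w k) k) i                    ≡⟨ lookup-flipUpTo (flipUpTo w k) k i ⟩
    lookup (flipUpTo w k) i xor (toℕ i ≤ᵇ toℕ k)             ≡⟨ cong (_xor _) (lookup-flipUpTo w k i) ⟩
    (lookup w i xor (toℕ i ≤ᵇ toℕ k)) xor (toℕ i ≤ᵇ toℕ k)   ≡⟨ xor-cancelʳ (lookup w i) _ ⟩
    lookup w i                                               ∎
    where open ≡-Reasoning

  flipUpTo-zero : ∀ (w : Vec Bool n) k → toℕ k ≡ 0 → flipUpTo w k ≡ flipBit w k
  flipUpTo-zero w k k≡0 = vec-ext λ i → begin
    lookup (flipUpTo w k) i             ≡⟨ lookup-flipUpTo w k i ⟩
    lookup w i xor (toℕ i ≤ᵇ toℕ k)     ≡⟨ cong (λ a → lookup w i xor (toℕ i ≤ᵇ a)) k≡0 ⟩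
    lookup w i xor (toℕ i ≤ᵇ 0)         ≡⟨ cong (lookup w i xor_) (≤ᵇ-zero (toℕ i)) ⟩
    lookup w i xor (toℕ i ≡ᵇ 0)         ≡⟨ cong (λ a → lookup w i xor (toℕ i ≡ᵇ a)) k≡0 ⟨
    lookup w i xor (toℕ i ≡ᵇ toℕ k)     ≡⟨ lookup-flipBit w k i ⟨
    lookup (flipBit w k) i              ∎
    where open ≡-Reasoning

  flipUpTo-suc : ∀ (w : Vec Bool n) r s → toℕ s ≡ suc (toℕ r) →
                 flipUpTo w s ≡ flipBit (flipUpTo w r) s
  flipUpTo-suc w r s s≡1+r = vec-ext λ i → begin
    lookup (flipUpTo w s) i                                  ≡⟨ lookup-flipUpTo w s i ⟩
    lookup w i xor (toℕ i ≤ᵇ toℕ s)                          ≡⟨ cong (lookup w i xor_) (≤ᵇ-suc (toℕ i) s≡1+r) ⟩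
    lookup w i xor ((toℕ i ≤ᵇ toℕ r) xor (toℕ i ≡ᵇ toℕ s))   ≡⟨ xor-assoc (lookup w i) _ _ ⟨
    (lookup w i xor (toℕ i ≤ᵇ toℕ r)) xor (toℕ i ≡ᵇ toℕ s)   ≡⟨ cong (_xor _) (lookup-flipUpTo w r i) ⟨
    lookup (flipUpTo w r) i xor (toℕ i ≡ᵇ toℕ s)             ≡⟨ lookup-flipBit (flipUpTo w r) s i ⟨
    lookup (flipBit (flipUpTo w r) s) i                      ∎
    where open ≡-Reasoning

  flipBit∘flipUpTo-suc : ∀ (w : Vec Bool n) r s → toℕ s ≡ suc (toℕ r) →
                         flipBit (flipUpTo w s) s ≡ flipUpTo w r
  flipBit∘flipUpTo-suc w r s s≡1+r = begin
    flipBit (flipUpTo w s) s               ≡⟨ cong (λ x → flipBit x s) (flipUpTo-suc w r s s≡1+r) ⟩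
    flipBit (flipBit (flipUpTo w r) s) s   ≡⟨ flipBit-involutive (flipUpTo w r) s ⟩
    flipUpTo w r                           ∎
    where open ≡-Reasoning

  flipUpTo∘flipUpTo-suc : ∀ (w : Vec Bool n) r s → toℕ s ≡ suc (toℕ r) →
                          flipUpTo (flipUpTo w r) s ≡ flipBit w s
  flipUpTo∘flipUpTo-suc w r s s≡1+r = begin
    flipUpTo (flipUpTo w r) s               ≡⟨ flipUpTo-suc (flipUpTo w r) r s s≡1+r ⟩
    flipBit (flipUpTo (flipUpTo w r) r) s   ≡⟨ cong (λ x → flipBit x s) (flipUpTo-involutive w r) ⟩
    flipBit w s                             ∎
    where open ≡-Reasoning

  flipUpTo∘flipUpTo-pred : ∀ (w : Vec Bool n) r s → toℕ s ≡ suc (toℕ r) →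
                           flipUpTo (flipUpTo w s) r ≡ flipBit w s
  flipUpTo∘flipUpTo-pred w r s s≡1+r = begin
    flipUpTo (flipUpTo w s) r               ≡⟨ flipBit∘flipUpTo-suc (flipUpTo w s) r s s≡1+r ⟨
    flipBit (flipUpTo (flipUpTo w s) s) s   ≡⟨ cong (λ x → flipBit x s) (flipUpTo-involutive w s) ⟩
    flipBit w s                             ∎
    where open ≡-Reasoning

  same-mask : ∀ (w : Vec Bool n) {x y a b} i → x ≡ y →
              lookup x i ≡ lookup w i xor a → lookup y i ≡ lookup w i xor b → a ≡ b
  same-mask w i refl x[i] y[i] = xor-injectiveʳ (lookup w i) (trans (sym x[i]) y[i])

  flipBit-injective : ∀ (w : Vec Bool n) {k k′} → flipBit w k ≡ flipBit w k′ → k ≡ k′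
  flipBit-injective w {k} {k′} e = toℕ-injective (≡ᵇ⇒≡ _ _ (subst T masks-agree (≡⇒≡ᵇ (toℕ k) _ refl)))
    where masks-agree = same-mask w k e (lookup-flipBit w k k) (lookup-flipBit w k′ k)

  flipUpTo-injective : ∀ (w : Vec Bool n) {k k′} → flipUpTo w k ≡ flipUpTo w k′ → k ≡ k′
  flipUpTo-injective w e = toℕ-injective (≤-antisym (≤-of e) (≤-of (sym e)))
    where
    ≤-of : ∀ {k k′} → flipUpTo w k ≡ flipUpTo w k′ → toℕ k ≤ toℕ k′
    ≤-of {k} {k′} e = ≤ᵇ⇒≤ _ _ (subst T masks-agree (≤⇒≤ᵇ (≤-refl {toℕ k})))
      where masks-agree = same-mask w k e (lookup-flipUpTo w k k) (lookup-flipUpTo w k′ k)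

  flipBit-≢ : ∀ (w : Vec Bool n) k → flipBit w k ≢ w
  flipBit-≢ w k e =
    subst T (same-mask w k e (lookup-flipBit w k k) (sym (xor-identityʳ _))) (≡⇒≡ᵇ (toℕ k) _ refl)

  flipUpTo-≢ : ∀ (w : Vec Bool n) k → flipUpTo w k ≢ w
  flipUpTo-≢ w k e =
    subst T (same-mask w k e (lookup-flipUpTo w k k) (sym (xor-identityʳ _))) (≤⇒≤ᵇ (≤-refl {toℕ k}))

flipBit≢flipUpTo : ∀ {n} (w : Vec Bool (suc n)) k j → 1 ≤ toℕ j → flipBit w k ≢ flipUpTo w j
flipBit≢flipUpTo w k j 1≤j e = <⇒≢ 1≤j (trans 0≡k (sym j≡k))
  where
  0≡k : 0 ≡ toℕ k
  0≡k = ≡ᵇ⇒≡ _ _ (subst T (sym (same-mask w zero e (lookup-flipBit w k zero) (lookup-flipUpTo w j zero))) tt)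
  j≡k : toℕ j ≡ toℕ k
  j≡k = ≡ᵇ⇒≡ _ _ (subst T (sym (same-mask w j e (lookup-flipBit w k j) (lookup-flipUpTo w j j)))
                          (≤⇒≤ᵇ (≤-refl {toℕ j})))

AQAdj⇒≢ : ∀ {n} {w x : Vec Bool n} → AQAdj w x → x ≢ w
AQAdj⇒≢ (hyp k) = flipBit-≢ _ k
AQAdj⇒≢ (aug k _) = flipUpTo-≢ _ k

flipUpTo-adjacent : ∀ {n} (w : Vec Bool n) k → AQAdj w (flipUpTo w k)
flipUpTo-adjacent w zero = subst (AQAdj w) (sym (flipUpTo-zero w zero refl)) (hyp zero)
flipUpTo-adjacent w (suc k) = aug (suc k) (s≤s z≤n)

module _ {n : ℕ} where

  neighbours : Vec Bool (suc n) → List (Vec Bool (suc n))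
  neighbours c = List.tabulate (flipBit c) ++ List.tabulate (flipUpTo c ∘ suc)

  neighbours-adjacent : ∀ c → All (AQAdj c) (neighbours c)
  neighbours-adjacent c = All.++⁺ (All.tabulate⁺ hyp) (All.tabulate⁺ λ k → aug (suc k) (s≤s z≤n))

  ∈-neighbours : ∀ {c x} → AQAdj c x → x ∈ neighbours c
  ∈-neighbours {c} (hyp k) = ∈-++⁺ˡ (∈-tabulate⁺ {f = flipBit c} k)
  ∈-neighbours {c} (aug (suc k) _) = ∈-++⁺ʳ (List.tabulate (flipBit c)) (∈-tabulate⁺ k)

  neighbours-unique : ∀ c → Unique (neighbours c)
  neighbours-unique c =
    Unique.++⁺ (Unique.tabulate⁺ {f = flipBit c} (flipBit-injective c))
               (Unique.tabulate⁺ {f = flipUpTo c ∘ suc} (suc-injective ∘ flipUpTo-injective c))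
               disjoint
    where
    disjoint : Disjoint (List.tabulate (flipBit c)) (List.tabulate (flipUpTo c ∘ suc))
    disjoint (x∈bits , x∈prefixes)
      with ∈-tabulate⁻ {f = flipBit c} x∈bits | ∈-tabulate⁻ {f = flipUpTo c ∘ suc} x∈prefixes
    ... | k , refl | j , e = flipBit≢flipUpTo c k (suc j) (s≤s z≤n) e

  centre∉neighbours : ∀ c → c ∉ neighbours c
  centre∉neighbours c c∈ = AQAdj⇒≢ (All.lookup (neighbours-adjacent c) c∈) refl

  length-neighbours : ∀ c → length (neighbours c) ≡ suc n + n
  length-neighbours c =
    trans (length-++ (List.tabulate (flipBit c)))
          (cong₂ _+_ (length-tabulate (flipBit c)) (length-tabulate (flipUpTo c ∘ suc)))

module Cut (k : ℕ) where

  n : ℕ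
  n = 3 + k

  V : Set
  V = Vec Bool n

  _≟V_ : DecidableEquality V
  _≟V_ = ≡-dec Bool._≟_

  u v : V
  u = replicate n false
  v = flipBit (flipBit u zero) (suc (suc zero))

  Pair : Set
  Pair = Fin ⌊ n /2⌋

  evenPos oddPos : Pair → Fin n
  evenPos i = fromℕ< (<⇒≤ (m<⌊n/2⌋⇒1+m*2<n (toℕ<n i)))
  oddPos i = fromℕ< (m<⌊n/2⌋⇒1+m*2<n (toℕ<n i))

  toℕ-evenPos : ∀ i → toℕ (evenPos i) ≡ toℕ i * 2
  toℕ-evenPos i = toℕ-fromℕ< _

  toℕ-oddPos : ∀ i → toℕ (oddPos i) ≡ suc (toℕ i * 2)
  toℕ-oddPos i = toℕ-fromℕ< (m<⌊n/2⌋⇒1+m*2<n (toℕ<n i))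

  oddPos≡1+evenPos : ∀ i → toℕ (oddPos i) ≡ suc (toℕ (evenPos i))
  oddPos≡1+evenPos i = trans (toℕ-oddPos i) (cong suc (sym (toℕ-evenPos i)))

  pairOf : ∀ j → suc (j * 2) < n → Pair
  pairOf j 1+j*2<n = fromℕ< (1+m*2<n⇒m<⌊n/2⌋ {j} 1+j*2<n)

  toℕ-oddPos-pairOf : ∀ j (1+j*2<n : suc (j * 2) < n) → toℕ (oddPos (pairOf j 1+j*2<n)) ≡ suc (j * 2)
  toℕ-oddPos-pairOf j 1+j*2<n =
    trans (toℕ-oddPos (pairOf j 1+j*2<n))
          (cong (λ a → suc (a * 2)) (toℕ-fromℕ< (1+m*2<n⇒m<⌊n/2⌋ {j} 1+j*2<n)))

  data Slot (t : Fin n) : Set where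
    bottom : t ≡ evenPos zero → Slot t
    odd    : ∀ i → t ≡ oddPos i → Slot t
    even   : ∀ i → toℕ t ≡ suc (toℕ (oddPos i)) → Slot t

  slot : ∀ t → Slot t
  slot t = from-parity (parityView (toℕ t)) refl
    where
    from-parity : ∀ {a} → ParityView a → toℕ t ≡ a → Slot t
    from-parity zero t≡0 = bottom (toℕ-injective t≡0)
    from-parity (odd j) t≡ = odd (pairOf j h) (toℕ-injective (trans t≡ (sym (toℕ-oddPos-pairOf j h))))
      where
      h : suc (j * 2) < n
      h = subst (_< n) t≡ (toℕ<n t)
    from-parity (even j) t≡ = even (pairOf j h) (trans t≡ (cong suc (sym (toℕ-oddPos-pairOf j h))))
      where
      h : suc (j * 2) < n
      h = <⇒≤ (subst (_< n) t≡ (toℕ<n t))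

  -- In the paper's 1-based numbering, centreOf i is ū^{2i+2} and the list  required i  consists of
  -- ū^{2i+1} and u^{2i+2}, followed by ū^{2i+3} and u^{2i+3} when 2i+3 ≤ n.
  centreOf : Pair → V
  centreOf i = flipUpTo u (oddPos i)

  requiredAbove : ∀ i → Dec (suc (toℕ (oddPos i)) < n) → List V
  requiredAbove i (yes h) = flipBit (centreOf i) (fromℕ< h) ∷ flipUpTo (centreOf i) (fromℕ< h) ∷ []
  requiredAbove i (no _) = []

  required : Pair → List V
  required i = flipBit (centreOf i) (oddPos i) ∷ flipUpTo (centreOf i) (evenPos i)
             ∷ requiredAbove i (suc (toℕ (oddPos i)) <? n)

  |required|≤4 : ∀ i → length (required i) ≤ 4
  |required|≤4 i = s≤s (s≤s (|requiredAbove|≤2 (suc (toℕ (oddPos i)) <? n)))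
    where
    |requiredAbove|≤2 : ∀ d → length (requiredAbove i d) ≤ 2
    |requiredAbove|≤2 (yes _) = ≤-refl
    |requiredAbove|≤2 (no _) = z≤n

  ∈-requiredAbove : ∀ i {t} d → toℕ t ≡ suc (toℕ (oddPos i)) →
                    flipBit (centreOf i) t ∈ requiredAbove i d × flipUpTo (centreOf i) t ∈ requiredAbove i d
  ∈-requiredAbove i (yes h) t≡ with refl ← toℕ-injective (trans t≡ (sym (toℕ-fromℕ< h))) =
    here refl , there (here refl)
  ∈-requiredAbove i {t} (no ¬h) t≡ = ⊥-elim (¬h (subst (_< n) t≡ (toℕ<n t)))

  lookup-centreOf : ∀ i p → lookup (centreOf i) p ≡ (toℕ p ≤ᵇ suc (toℕ i * 2))
  lookup-centreOf i p
    rewrite lookup-flipUpTo u (oddPos i) p | lookup-replicate {n = n} p false | toℕ-oddPos i = refl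

  lookup-v : ∀ p → lookup v p ≡ (toℕ p ≡ᵇ 0) xor (toℕ p ≡ᵇ 2)
  lookup-v p
    rewrite lookup-flipBit (flipBit u zero) (suc (suc zero)) p | lookup-flipBit u zero p
          | lookup-replicate {n = n} p false = refl

  differ-at : ∀ p {x y : V} → lookup x p ≢ lookup y p → x ≢ y
  differ-at p x[p]≢y[p] = x[p]≢y[p] ∘ cong (λ z → lookup z p)

  u≢v : u ≢ v
  u≢v = differ-at zero λ ()

  v≢centreOf : ∀ i → v ≢ centreOf i
  v≢centreOf i = differ-at (suc zero) λ v[1]≡c[1] →
    contradiction (trans v[1]≡c[1] (lookup-centreOf i (suc zero))) λ ()

  centre-flip≢v : ∀ (i : Pair) τ →
                  ¬ (∀ (p : Fin n) → (toℕ p ≤ᵇ suc (toℕ i * 2)) xor (toℕ p ≡ᵇ τ) ≡ (toℕ p ≡ᵇ 0) xor (toℕ p ≡ᵇ 2))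
  centre-flip≢v i zero agree = contradiction (agree (suc zero)) λ ()
  centre-flip≢v i (suc (suc τ)) agree = contradiction (agree (suc zero)) λ ()
  centre-flip≢v zero (suc zero) agree = contradiction (agree (suc (suc zero))) λ ()
  centre-flip≢v (suc i) (suc zero) agree =
    contradiction (subst agreeAt (toℕ-fromℕ< 3<n) (agree (fromℕ< 3<n))) λ ()
    where
    3<n : 3 < n
    3<n = ≤-trans (s≤s (s≤s (s≤s (s≤s z≤n)))) (m<⌊n/2⌋⇒1+m*2<n (toℕ<n (suc i)))
    agreeAt : ℕ → Set
    agreeAt a = (a ≤ᵇ suc (toℕ (suc i) * 2)) xor (a ≡ᵇ 1) ≡ (a ≡ᵇ 0) xor (a ≡ᵇ 2)

  N[centreOf]∌v : ∀ i {x} → AQAdj (centreOf i) x → x ≢ v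
  N[centreOf]∌v i (aug t _) = differ-at zero λ ()
  N[centreOf]∌v i (hyp t) x≡v = centre-flip≢v i (toℕ t) λ (p : Fin n) → begin
    (toℕ p ≤ᵇ suc (toℕ i * 2)) xor (toℕ p ≡ᵇ toℕ t) ≡⟨ cong (_xor _) (lookup-centreOf i p) ⟨
    lookup (centreOf i) p xor (toℕ p ≡ᵇ toℕ t)       ≡⟨ lookup-flipBit (centreOf i) t p ⟨
    lookup (flipBit (centreOf i) t) p                ≡⟨ cong (λ z → lookup z p) x≡v ⟩
    lookup v p                                       ≡⟨ lookup-v p ⟩
    (toℕ p ≡ᵇ 0) xor (toℕ p ≡ᵇ 2)                     ∎
    where open ≡-Reasoning

  module Stars {m : ℕ} (4≤m : 4 ≤ m) (m≤2n∸2 : m ≤ 2 * n ∸ 2) where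

    m<degree : ∀ (c : V) → m < length (neighbours c)
    m<degree c = subst (m <_) (sym (length-neighbours c))
                       (s≤s (≤-trans m≤2n∸2 (≤-reflexive (2*[1+n]∸2≡n+n (2 + k)))))

    module StarAt (i : Pair) =
      StarAvoiding {AQ n} _≟V_ (neighbours-unique (centreOf i)) (neighbours-adjacent (centreOf i))
                   (centre∉neighbours (centreOf i)) u (required i) (≤-trans (|required|≤4 i) 4≤m)
                   (m<degree (centreOf i))

    cut : List (Star (AQ n) m)
    cut = List.map StarAt.star (allFin ⌊ n /2⌋)

    length-cut : length cut ≡ ⌊ n /2⌋
    length-cut = trans (length-map StarAt.star (allFin _)) (length-tabulate id)

    InV-cut⁺ : ∀ i {x} → x ≡ centreOf i ⊎ x ∈ leaves (StarAt.star i) → InV cut x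
    InV-cut⁺ i = lose (∈-map⁺ StarAt.star (∈-allFin i))

    -- Supplying xs keeps unification from unfolding the stars, which is very slow.
    InV-cut⁻ : ∀ {x} → InV cut x → ∃ λ i → x ≡ centreOf i ⊎ x ∈ leaves (StarAt.star i)
    InV-cut⁻ {x} x∈cut =
      satisfied (map⁻ {f = StarAt.star} {P = λ S → x ≡ centre S ⊎ x ∈ leaves S} {xs = allFin _} x∈cut)

    required∈cut : ∀ i {w x} → w ≡ x → x ∈ required i → AQAdj (centreOf i) x → w ≢ u → InV cut w
    required∈cut i refl x∈required c~x x≢u =
      InV-cut⁺ i (inj₂ (StarAt.wanted∈leaves i x∈required (∈-neighbours c~x) x≢u))

    flipBit-covered : ∀ t → Slot t → flipBit u t ≢ u → InV cut (flipBit u t)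
    flipBit-covered t (bottom refl) =
      required∈cut zero
        (trans (sym (flipUpTo-zero u (evenPos zero) (toℕ-evenPos zero)))
               (sym (flipBit∘flipUpTo-suc u (evenPos zero) (oddPos zero) (oddPos≡1+evenPos zero))))
        (here refl) (hyp (oddPos zero))
    flipBit-covered t (odd i refl) =
      required∈cut i (sym (flipUpTo∘flipUpTo-pred u (evenPos i) (oddPos i) (oddPos≡1+evenPos i)))
        (there (here refl)) (flipUpTo-adjacent (centreOf i) (evenPos i))
    flipBit-covered t (even i t≡) =
      required∈cut i (sym (flipUpTo∘flipUpTo-suc u (oddPos i) t t≡))
        (there (there (proj₂ (∈-requiredAbove i (suc (toℕ (oddPos i)) <? n) t≡))))
        (flipUpTo-adjacent (centreOf i) t)

    flipUpTo-covered : ∀ t → Slot t → 1 ≤ toℕ t → flipUpTo u t ≢ u → InV cut (flipUpTo u t)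
    flipUpTo-covered t (bottom refl) 1≤t _ = contradiction (sym (toℕ-evenPos zero)) (<⇒≢ 1≤t)
    flipUpTo-covered t (odd i refl) _ _ = InV-cut⁺ i (inj₁ refl)
    flipUpTo-covered t (even i t≡) _ =
      required∈cut i (flipUpTo-suc u (oddPos i) t t≡)
        (there (there (proj₁ (∈-requiredAbove i (suc (toℕ (oddPos i)) <? n) t≡)))) (hyp t)

    N[u]⊆cut : ∀ {w} → AQAdj u w → InV cut w
    N[u]⊆cut (hyp t) = flipBit-covered t (slot t) (AQAdj⇒≢ (hyp t))
    N[u]⊆cut (aug t 1≤t) = flipUpTo-covered t (slot t) 1≤t (AQAdj⇒≢ (aug t 1≤t))

    u∉cut : ¬ InV cut u
    u∉cut = u∉stars ∘ InV-cut⁻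
      where
      u∉stars : ¬ (∃ λ i → u ≡ centreOf i ⊎ u ∈ leaves (StarAt.star i))
      u∉stars (i , inj₁ u≡c) = flipUpTo-≢ u (oddPos i) (sym u≡c)
      u∉stars (i , inj₂ u∈leaves) = StarAt.u∉leaves i u∈leaves

    v∉cut : ¬ InV cut v
    v∉cut = v∉stars ∘ InV-cut⁻
      where
      v∉stars : ¬ (∃ λ i → v ≡ centreOf i ⊎ v ∈ leaves (StarAt.star i))
      v∉stars (i , inj₁ v≡c) = v≢centreOf i v≡c
      v∉stars (i , inj₂ v∈leaves) =
        N[centreOf]∌v i (All.lookup (leaves-adj (StarAt.star i)) v∈leaves) refl

    κ≤⌊n/2⌋ : κStar≤ (AQ n) m ⌊ n /2⌋
    κ≤⌊n/2⌋ = cut , inj₁ (u , v , u∉cut , v∉cut , isolated⇒¬Reach u≢v N[u]⊆cut) , ≤-reflexive length-cut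

lemma4p14 : (m n : ℕ) → 4 ≤ m → m ≤ 2 * n ∸ 2 →
    κStar≤ (AQ n) m ⌈ (n ∸ 1) /2⌉
lemma4p14 m 0 4≤m m≤0 = contradiction (≤-trans 4≤m m≤0) λ ()
lemma4p14 m 1 4≤m m≤0 = contradiction (≤-trans 4≤m m≤0) λ ()
lemma4p14 m 2 4≤m m≤2 = contradiction (≤-trans 4≤m m≤2) λ { (s≤s (s≤s ())) }
lemma4p14 m (suc (suc (suc k))) 4≤m m≤2n∸2 = Cut.Stars.κ≤⌊n/2⌋ k 4≤m m≤2n∸2
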